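{- Let $k\ge 1$ and $n\ge k(k+1)^2+1$. Then the Kneser graph $K(n,k)$ has no complete conflict-free coloring with $k+1$ colors; that is, $\chi_{CF}(K(n,k))\ge k+2$.
   Context: The Kneser graph $K(n,k)$ has as vertices the $k$-element subsets of $\{1,\dots,n\}$, two being adjacent iff they are disjoint. A complete conflict-free coloring with $m$ colors is a map $C:V\to\{1,\dots,m\}$ such that every vertex $v$ has some color $i$ with $|N(v)\cap C^{ -1}(i)|=1$, where $N(v)$ is the open neighborhood; $\chi_{CF}$ is the minimum such $m$. -}

module Defs where

open import Data.Nat using (ℕ; suc)
open import Data.Fin using (Fin)
open import Data.Fin.Subset using (Subset; ∣_∣; _∩_; Empty)
open import Data.Product using (Σ; ∃; _×_; proj₁)
open import Relation.Binary.PropositionalEquality using (_≡_)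

KVertex : ℕ → ℕ → Set
KVertex n k = Σ (Subset n) (λ s → ∣ s ∣ ≡ k)

Adj : ∀ {n k} → KVertex n k → KVertex n k → Set
Adj u v = Empty (proj₁ u ∩ proj₁ v)

-- |N(v) ∩ C⁻¹(i)| = 1 : exactly one neighbour of v receives colour i
-- (vertices are identified by their underlying subsets)
UniqueColouredNeighbour : ∀ {n k m} → (KVertex n k → Fin m) → KVertex n k → Fin m → Set
UniqueColouredNeighbour {n} {k} C v i =
  ∃ λ (u : KVertex n k) → Adj v u × C u ≡ i ×
    (∀ (w : KVertex n k) → Adj v w → C w ≡ i → proj₁ w ≡ proj₁ u)

IsCompleteCFColouring : ∀ {n k m} → (KVertex n k → Fin m) → Set
IsCompleteCFColouring {n} {k} {m} C =
  ∀ (v : KVertex n k) → ∃ λ (i : Fin m) → UniqueColouredNeighbour C v i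

module Submission where

-- Call a colour j "absent" from R if no k-set disjoint from R has colour j, and
-- "repeated" on R if two distinct k-sets disjoint from R have colour j.  Given R,
-- a colour that is neither can be made absent by adding one element to R (an
-- element of its unique witness).  Repeating this greedily ('stabilise') gives a
-- set R together with at least ∣R∣ "settled" colours absent from R, such that
-- every colour is settled or repeated.
--   * If ∣R∣ > k then every colour is absent, yet some k-set avoids R.
--   * If ∣R∣ ≤ k, let X collect two witnesses of every repeated colour
--     (∣X∣ ≤ c·2k).  Complete R to a k-set z avoiding X outside R.  The unique
--     neighbour u of z in its distinguished colour i avoids R, so i is repeated;
--     but both witnesses of i lie in X, hence are neighbours of z of colour i.

open import Defs
open import Data.Nat using (ℕ; zero; suc; _+_; _*_; _≤_; _∸_; z≤n; s≤s)
open import Data.Nat.Properties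
open import Data.Nat.Tactic.RingSolver using (solve-∀)
open import Data.Fin using (Fin; zero; suc)
open import Data.Fin.Properties using (any?) renaming (_≟_ to _≟ᶠ_)
open import Data.Fin.Subset
open import Data.Fin.Subset.Properties
open import Data.Vec using ([]; _∷_)
open import Data.Vec.Properties using (≡-dec)
import Data.Bool.Properties as Bool
open import Data.Product using (Σ; ∃; ∃₂; _×_; _,_; proj₁; proj₂)
open import Data.Sum using (_⊎_; inj₁; inj₂; map₁)
open import Data.Empty using (⊥-elim)
open import Function using (id; _∘_)
open import Relation.Nullary using (¬_; Dec; yes; no)
open import Relation.Nullary.Decidable using (_×-dec_; ¬?)
open import Relation.Binary.PropositionalEquality

∣p∪q∣+∣p∩q∣ : ∀ {n} (p q : Subset n) → ∣ p ∪ q ∣ + ∣ p ∩ q ∣ ≡ ∣ p ∣ + ∣ q ∣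
∣p∪q∣+∣p∩q∣ []            []            = refl
∣p∪q∣+∣p∩q∣ (inside ∷ p)  (inside ∷ q)  =
  cong suc (trans (+-suc ∣ p ∪ q ∣ ∣ p ∩ q ∣)
                  (trans (cong suc (∣p∪q∣+∣p∩q∣ p q)) (sym (+-suc ∣ p ∣ ∣ q ∣))))
∣p∪q∣+∣p∩q∣ (inside ∷ p)  (outside ∷ q) = cong suc (∣p∪q∣+∣p∩q∣ p q)
∣p∪q∣+∣p∩q∣ (outside ∷ p) (inside ∷ q)  =
  trans (cong suc (∣p∪q∣+∣p∩q∣ p q)) (sym (+-suc ∣ p ∣ ∣ q ∣))
∣p∪q∣+∣p∩q∣ (outside ∷ p) (outside ∷ q) = ∣p∪q∣+∣p∩q∣ p q

∣p∪q∣≤∣p∣+∣q∣ : ∀ {n} (p q : Subset n) → ∣ p ∪ q ∣ ≤ ∣ p ∣ + ∣ q ∣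
∣p∪q∣≤∣p∣+∣q∣ p q = ≤-trans (m≤m+n ∣ p ∪ q ∣ ∣ p ∩ q ∣) (≤-reflexive (∣p∪q∣+∣p∩q∣ p q))

∣p∪q∣≡∣p∣+∣q∣ : ∀ {n} (p q : Subset n) → Empty (p ∩ q) → ∣ p ∪ q ∣ ≡ ∣ p ∣ + ∣ q ∣
∣p∪q∣≡∣p∣+∣q∣ {n} p q disjoint = begin
  ∣ p ∪ q ∣                ≡⟨ sym (+-identityʳ ∣ p ∪ q ∣) ⟩
  ∣ p ∪ q ∣ + 0            ≡⟨ cong (∣ p ∪ q ∣ +_) (sym ∣p∩q∣≡0) ⟩
  ∣ p ∪ q ∣ + ∣ p ∩ q ∣    ≡⟨ ∣p∪q∣+∣p∩q∣ p q ⟩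
  ∣ p ∣ + ∣ q ∣            ∎
  where
  open ≡-Reasoning
  ∣p∩q∣≡0 : ∣ p ∩ q ∣ ≡ 0
  ∣p∩q∣≡0 = trans (cong ∣_∣ (Empty-unique disjoint)) (∣⊥∣≡0 n)

positive⇒nonempty : ∀ {n} (p : Subset n) → 1 ≤ ∣ p ∣ → Nonempty p
positive⇒nonempty {n} p 1≤∣p∣ with nonempty? p
... | yes ne = ne
... | no empty = ⊥-elim (1+n≰n (≤-trans 1≤∣p∣ (≤-reflexive ∣p∣≡0)))
  where
  ∣p∣≡0 : ∣ p ∣ ≡ 0
  ∣p∣≡0 = trans (cong ∣_∣ (Empty-unique empty)) (∣⊥∣≡0 n)

subsetOfSize : ∀ {n} m (p : Subset n) → m ≤ ∣ p ∣ → ∃ λ q → q ⊆ p × ∣ q ∣ ≡ m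
subsetOfSize {n} zero p _ = ⊥ , ⊥⊆ , ∣⊥∣≡0 n
subsetOfSize (suc m) (inside ∷ p) (s≤s m≤∣p∣) with subsetOfSize m p m≤∣p∣
... | q , q⊆p , ∣q∣≡m = inside ∷ q , s⊆s q⊆p , cong suc ∣q∣≡m
subsetOfSize (suc m) (outside ∷ p) m≤∣p∣ with subsetOfSize (suc m) p m≤∣p∣
... | q , q⊆p , ∣q∣≡m = outside ∷ q , s⊆s q⊆p , ∣q∣≡m

complementRoom : ∀ {n} (p : Subset n) m → m + ∣ p ∣ ≤ n → m ≤ ∣ ∁ p ∣
complementRoom p m room =
  subst (m ≤_) (sym (∣∁p∣≡n∸∣p∣ p)) (m+n≤o⇒m≤o∸n m room)

∩-empty-sym : ∀ {n} (p q : Subset n) → Empty (p ∩ q) → Empty (q ∩ p)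
∩-empty-sym p q empty (x , x∈q∩p) with x∈p∩q⁻ q p x∈q∩p
... | x∈q , x∈p = empty (x , x∈p∩q⁺ (x∈p , x∈q))

∩-empty-antiˡ : ∀ {n} {p p′ : Subset n} (q : Subset n) →
  p ⊆ p′ → Empty (p′ ∩ q) → Empty (p ∩ q)
∩-empty-antiˡ {p = p} q p⊆p′ empty (x , x∈p∩q) with x∈p∩q⁻ p q x∈p∩q
... | x∈p , x∈q = empty (x , x∈p∩q⁺ (p⊆p′ x∈p , x∈q))

∪-∩-empty : ∀ {n} (p q r : Subset n) →
  Empty (p ∩ r) → Empty (q ∩ r) → Empty ((p ∪ q) ∩ r)
∪-∩-empty p q r p∩r q∩r (x , x∈p∪q∩r) with x∈p∩q⁻ (p ∪ q) r x∈p∪q∩r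
... | x∈p∪q , x∈r with x∈p∪q⁻ p q x∈p∪q
...   | inj₁ x∈p = p∩r (x , x∈p∩q⁺ (x∈p , x∈r))
...   | inj₂ x∈q = q∩r (x , x∈p∩q⁺ (x∈q , x∈r))

∁-separates : ∀ {n} {p q r : Subset n} → p ⊆ r → q ⊆ ∁ r → Empty (p ∩ q)
∁-separates {p = p} {q} p⊆r q⊆∁r (x , x∈p∩q) with x∈p∩q⁻ p q x∈p∩q
... | x∈p , x∈q = x∈∁p⇒x∉p (q⊆∁r x∈q) (p⊆r x∈p)

⋃ᶠ : ∀ {n} m → (Fin m → Subset n) → Subset n
⋃ᶠ zero    f = ⊥
⋃ᶠ (suc m) f = f zero ∪ ⋃ᶠ m (f ∘ suc)

⊆⋃ᶠ : ∀ {n} m (f : Fin m → Subset n) i → f i ⊆ ⋃ᶠ m f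
⊆⋃ᶠ (suc m) f zero    = p⊆p∪q (⋃ᶠ m (f ∘ suc))
⊆⋃ᶠ (suc m) f (suc i) = q⊆p∪q (f zero) (⋃ᶠ m (f ∘ suc)) ∘ ⊆⋃ᶠ m (f ∘ suc) i

∣⋃ᶠ∣≤ : ∀ {n} m (f : Fin m → Subset n) b → (∀ i → ∣ f i ∣ ≤ b) → ∣ ⋃ᶠ m f ∣ ≤ m * b
∣⋃ᶠ∣≤ {n} zero f b _ = ≤-reflexive (∣⊥∣≡0 n)
∣⋃ᶠ∣≤ (suc m) f b bounded =
  ≤-trans (∣p∪q∣≤∣p∣+∣q∣ (f zero) (⋃ᶠ m (f ∘ suc)))
          (+-mono-≤ (bounded zero) (∣⋃ᶠ∣≤ m (f ∘ suc) b (bounded ∘ suc)))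

_≟ₛ_ : ∀ {n} (p q : Subset n) → Dec (p ≡ q)
_≟ₛ_ = ≡-dec Bool._≟_

module Colouring {n k c : ℕ} (C : KVertex n k → Fin c) where

  colour-irrelevant : ∀ {s} (p q : ∣ s ∣ ≡ k) → C (s , p) ≡ C (s , q)
  colour-irrelevant {s} p q = cong (λ r → C (s , r)) (≡-irrelevant p q)

  Witness : Fin c → Subset n → Subset n → Set
  Witness j R s = Σ (∣ s ∣ ≡ k) λ p → C (s , p) ≡ j × Empty (R ∩ s)

  Absent : Fin c → Subset n → Set
  Absent j R = ∀ s → ¬ Witness j R s

  Repeated : Fin c → Subset n → Set
  Repeated j R = ∃₂ λ s t → Witness j R s × Witness j R t × ¬ s ≡ t

  witness? : ∀ j R s → Dec (Witness j R s)
  witness? j R s with ∣ s ∣ ≟ k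
  ... | no ∣s∣≢k = no (∣s∣≢k ∘ proj₁)
  ... | yes p with C (s , p) ≟ᶠ j | nonempty? (R ∩ s)
  ...   | yes Cs≡j | no empty = yes (p , Cs≡j , empty)
  ...   | yes _    | yes meet = no λ { (_ , _ , empty) → empty meet }
  ...   | no Cs≢j  | _        =
    no λ { (q , Cs≡j , _) → Cs≢j (trans (colour-irrelevant p q) Cs≡j) }

  repeated? : ∀ j R → Dec (Repeated j R)
  repeated? j R = anySubset? λ s → anySubset? λ t →
    witness? j R s ×-dec witness? j R t ×-dec ¬? (s ≟ₛ t)

  witness-anti : ∀ {j R R′ s} → R ⊆ R′ → Witness j R′ s → Witness j R s
  witness-anti {s = s} R⊆R′ (p , colour , empty) = p , colour , ∩-empty-antiˡ s R⊆R′ empty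

  absent-mono : ∀ {j R R′} → R ⊆ R′ → Absent j R → Absent j R′
  absent-mono R⊆R′ absent s = absent s ∘ witness-anti R⊆R′

  onlyWitness-blocked : ∀ {j R s e} → e ∈ s →
    ¬ (∃ λ t → Witness j R t × ¬ t ≡ s) → Absent j (R ∪ ⁅ e ⁆)
  onlyWitness-blocked {R = R} {s} {e} e∈s noOther t wt@(_ , _ , empty) with t ≟ₛ s
  ... | yes refl = empty (e , x∈p∩q⁺ (q⊆p∪q R ⁅ e ⁆ (x∈⁅x⁆ e) , e∈s))
  ... | no t≢s   = noOther (t , witness-anti (p⊆p∪q ⁅ e ⁆) wt , t≢s)

  resolve : 1 ≤ k → ∀ j R →
    Repeated j R ⊎ ∃ λ R′ → R ⊆ R′ × ∣ R′ ∣ ≤ suc ∣ R ∣ × Absent j R′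
  resolve k≥1 j R with anySubset? (witness? j R)
  ... | no none = inj₂ (R , id , n≤1+n ∣ R ∣ , λ s w → none (s , w))
  ... | yes (s , ws) with anySubset? (λ t → witness? j R t ×-dec ¬? (t ≟ₛ s))
  ...   | yes (t , wt , t≢s) = inj₁ (t , s , wt , ws , t≢s)
  ...   | no noOther with positive⇒nonempty s (subst (1 ≤_) (sym (proj₁ ws)) k≥1)
  ...     | e , e∈s = inj₂ (R ∪ ⁅ e ⁆ , p⊆p∪q ⁅ e ⁆ , size , onlyWitness-blocked e∈s noOther)
    where
    size : ∣ R ∪ ⁅ e ⁆ ∣ ≤ suc ∣ R ∣
    size = ≤-trans (∣p∪q∣≤∣p∣+∣q∣ R ⁅ e ⁆)
                   (≤-reflexive (trans (cong (∣ R ∣ +_) (∣⁅x⁆∣≡1 e)) (+-comm ∣ R ∣ 1)))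

  record Partial : Set where
    field
      blocked  : Subset n
      settled  : Subset c
      absent   : ∀ {j} → j ∈ settled → Absent j blocked
      bounded  : ∣ blocked ∣ ≤ ∣ settled ∣
  open Partial

  Stable : Partial → Set
  Stable st = ∀ j → j ∈ settled st ⊎ Repeated j (blocked st)

  start : Partial
  start = record
    { blocked = ⊥ ; settled = ⊥ ; absent = ⊥-elim ∘ ∉⊥
    ; bounded = ≤-reflexive (trans (∣⊥∣≡0 n) (sym (∣⊥∣≡0 c))) }

  settle : (st : Partial) {j : Fin c} → j ∉ settled st → ∀ {R′} →
    blocked st ⊆ R′ → ∣ R′ ∣ ≤ suc ∣ blocked st ∣ → Absent j R′ →
    Σ Partial λ st′ → ∣ settled st′ ∣ ≡ suc ∣ settled st ∣
  settle st {j} j∉ {R′} R⊆R′ ∣R′∣≤ absentR′ = st′ , grows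
    where
    grows : ∣ settled st ∪ ⁅ j ⁆ ∣ ≡ suc ∣ settled st ∣
    grows = trans (∣p∪q∣≡∣p∣+∣q∣ (settled st) ⁅ j ⁆ new)
                  (trans (cong (∣ settled st ∣ +_) (∣⁅x⁆∣≡1 j)) (+-comm ∣ settled st ∣ 1))
      where
      new : Empty (settled st ∩ ⁅ j ⁆)
      new (x , x∈) with x∈p∩q⁻ (settled st) ⁅ j ⁆ x∈
      ... | x∈settled , x∈⁅j⁆ rewrite x∈⁅y⁆⇒x≡y j x∈⁅j⁆ = j∉ x∈settled
    absent′ : ∀ {i} → i ∈ settled st ∪ ⁅ j ⁆ → Absent i R′
    absent′ {i} i∈ with x∈p∪q⁻ (settled st) ⁅ j ⁆ i∈
    ... | inj₁ i∈settled = absent-mono R⊆R′ (absent st i∈settled)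
    ... | inj₂ i∈⁅j⁆ rewrite x∈⁅y⁆⇒x≡y j i∈⁅j⁆ = absentR′
    st′ : Partial
    st′ = record
      { blocked = R′ ; settled = settled st ∪ ⁅ j ⁆ ; absent = absent′
      ; bounded = ≤-trans ∣R′∣≤ (≤-trans (s≤s (bounded st)) (≤-reflexive (sym grows))) }

  noneOpen⇒stable : ∀ st →
    ¬ (∃ λ j → j ∉ settled st × ¬ Repeated j (blocked st)) → Stable st
  noneOpen⇒stable st noneOpen j with j ∈? settled st | repeated? j (blocked st)
  ... | yes j∈ | _       = inj₁ j∈
  ... | no _   | yes rep = inj₂ rep
  ... | no j∉  | no ¬rep = ⊥-elim (noneOpen (j , j∉ , ¬rep))

  classify : ∀ st → Stable st → ∀ j → Absent j (blocked st) ⊎ Repeated j (blocked st)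
  classify st stable j = map₁ (absent st) (stable j)

  stabilise : 1 ≤ k → ∀ f (st : Partial) → f + ∣ settled st ∣ ≡ c → Σ Partial Stable
  stabilise _ zero st all =
    st , λ j → inj₁ (subst (j ∈_) (sym (∣p∣≡n⇒p≡⊤ all)) ∈⊤)
  stabilise k≥1 (suc f) st count
    with any? (λ j → ¬? (j ∈? settled st) ×-dec ¬? (repeated? j (blocked st)))
  ... | no noneOpen = st , noneOpen⇒stable st noneOpen
  ... | yes (j , j∉ , ¬rep) with resolve k≥1 j (blocked st)
  ...   | inj₁ rep = ⊥-elim (¬rep rep)
  ...   | inj₂ (R′ , R⊆R′ , ∣R′∣≤ , absentR′) with settle st j∉ R⊆R′ ∣R′∣≤ absentR′
  ...     | st′ , grows =
    stabilise k≥1 f st′ (trans (cong (f +_) grows) (trans (+-suc f _) count))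

  RepeatedIn : Fin c → Subset n → Subset n → Set
  RepeatedIn j R X = ∃₂ λ s t →
    Witness j R s × Witness j R t × ¬ s ≡ t × s ⊆ X × t ⊆ X

  support : ∀ {j R} → Absent j R ⊎ Repeated j R → Subset n
  support (inj₁ _)           = ⊥
  support (inj₂ (s , t , _)) = s ∪ t

  ∣support∣≤ : ∀ {j R} (d : Absent j R ⊎ Repeated j R) → ∣ support d ∣ ≤ k + k
  ∣support∣≤ (inj₁ _) = ≤-trans (≤-reflexive (∣⊥∣≡0 n)) z≤n
  ∣support∣≤ (inj₂ (s , t , (∣s∣≡k , _) , (∣t∣≡k , _) , _)) =
    ≤-trans (∣p∪q∣≤∣p∣+∣q∣ s t) (≤-reflexive (cong₂ _+_ ∣s∣≡k ∣t∣≡k))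

  localise : ∀ {j R X} (d : Absent j R ⊎ Repeated j R) → support d ⊆ X →
    Absent j R ⊎ RepeatedIn j R X
  localise (inj₁ absent) _ = inj₁ absent
  localise (inj₂ (s , t , ws , wt , s≢t)) s∪t⊆X =
    inj₂ (s , t , ws , wt , s≢t , s∪t⊆X ∘ p⊆p∪q t , s∪t⊆X ∘ q⊆p∪q s t)

  gather : ∀ {R} → (∀ j → Absent j R ⊎ Repeated j R) →
    ∃ λ X → ∣ X ∣ ≤ c * (k + k) × (∀ j → Absent j R ⊎ RepeatedIn j R X)
  gather dichotomy =
    ⋃ᶠ c supports , ∣⋃ᶠ∣≤ c supports (k + k) (∣support∣≤ ∘ dichotomy) ,
    λ j → localise (dichotomy j) (⊆⋃ᶠ c supports j)
    where
    supports : Fin c → Subset n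
    supports = support ∘ dichotomy

  -- A vertex containing R and meeting X only inside R: it is adjacent to every
  -- k-set inside X that avoids R.
  centre : ∀ R X → ∣ R ∣ ≤ k → k + ∣ X ∣ ≤ n →
    ∃ λ (z : KVertex n k) → R ⊆ proj₁ z ×
      (∀ w → w ⊆ X → Empty (R ∩ w) → Empty (proj₁ z ∩ w))
  centre R X ∣R∣≤k room with subsetOfSize (k ∸ ∣ R ∣) (∁ (R ∪ X)) (complementRoom (R ∪ X) _ room′)
    where
    open ≤-Reasoning
    room′ : k ∸ ∣ R ∣ + ∣ R ∪ X ∣ ≤ n
    room′ = begin
      k ∸ ∣ R ∣ + ∣ R ∪ X ∣         ≤⟨ +-monoʳ-≤ (k ∸ ∣ R ∣) (∣p∪q∣≤∣p∣+∣q∣ R X) ⟩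
      k ∸ ∣ R ∣ + (∣ R ∣ + ∣ X ∣)   ≡⟨ +-assoc (k ∸ ∣ R ∣) ∣ R ∣ ∣ X ∣ ⟨
      k ∸ ∣ R ∣ + ∣ R ∣ + ∣ X ∣     ≡⟨ cong (_+ ∣ X ∣) (m∸n+n≡m ∣R∣≤k) ⟩
      k + ∣ X ∣                     ≤⟨ room ⟩
      n                             ∎
  ... | B , B⊆∁RX , ∣B∣≡k∸∣R∣ =
    (R ∪ B , ∣R∪B∣≡k) , p⊆p∪q B ,
    λ w w⊆X R∩w → ∪-∩-empty R B w R∩w
      (∩-empty-sym w B (∁-separates (q⊆p∪q R X ∘ w⊆X) B⊆∁RX))
    where
    ∣R∪B∣≡k : ∣ R ∪ B ∣ ≡ k
    ∣R∪B∣≡k = trans (∣p∪q∣≡∣p∣+∣q∣ R B (∁-separates (p⊆p∪q X) B⊆∁RX))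
                    (trans (cong (∣ R ∣ +_) ∣B∣≡k∸∣R∣) (m+[n∸m]≡n ∣R∣≤k))

  -- If every colour is absent from R, a vertex avoiding R has no possible colour.
  allAbsent-impossible : ∀ R → k + ∣ R ∣ ≤ n → ¬ (∀ j → Absent j R)
  allAbsent-impossible R room allAbsent with subsetOfSize k (∁ R) (complementRoom R k room)
  ... | B , B⊆∁R , ∣B∣≡k = allAbsent (C (B , ∣B∣≡k)) B (∣B∣≡k , refl , ∁-separates id B⊆∁R)

  -- The centre vertex has no uniquely coloured neighbour.
  centre-refutes : IsCompleteCFColouring C → ∀ R X → ∣ R ∣ ≤ k → k + ∣ X ∣ ≤ n →
    ¬ (∀ j → Absent j R ⊎ RepeatedIn j R X)
  centre-refutes cf R X ∣R∣≤k room dichotomy with centre R X ∣R∣≤k room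
  ... | z , R⊆z , adjacent with cf z
  ...   | i , (u , z∼u , Cu≡i , unique) = refute (dichotomy i)
    where
    u-witness : Witness i R (proj₁ u)
    u-witness = proj₂ u , Cu≡i , ∩-empty-antiˡ (proj₁ u) R⊆z z∼u
    -- a witness of i inside X is a neighbour of z of colour i, hence equals u
    is-u : ∀ {s} → s ⊆ X → Witness i R s → s ≡ proj₁ u
    is-u {s} s⊆X (∣s∣≡k , Cs≡i , R∩s) = unique (s , ∣s∣≡k) (adjacent s s⊆X R∩s) Cs≡i
    refute : ¬ (Absent i R ⊎ RepeatedIn i R X)
    refute (inj₁ absent) = absent (proj₁ u) u-witness
    refute (inj₂ (s , t , ws , wt , s≢t , s⊆X , t⊆X)) =
      s≢t (trans (is-u s⊆X ws) (sym (is-u t⊆X wt)))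

  small-refutes : IsCompleteCFColouring C → k + c * (k + k) ≤ n →
    ∀ st → Stable st → ¬ (∣ blocked st ∣ ≤ k)
  small-refutes cf room st stable ∣R∣≤k with gather (classify st stable)
  ... | X , ∣X∣≤ , classifyIn =
    centre-refutes cf (blocked st) X ∣R∣≤k (≤-trans (+-monoʳ-≤ k ∣X∣≤) room) classifyIn

  -- A state blocking more than k ≥ c-1 elements has settled every colour.
  large-refutes : c ≤ suc k → k + c ≤ n → ∀ st → ¬ ¬ (∣ blocked st ∣ ≤ k)
  large-refutes c≤1+k room st ∣R∣≰k =
    allAbsent-impossible (blocked st) (≤-trans (+-monoʳ-≤ k ∣R∣≤c) room)
      (λ j → absent st (subst (j ∈_) (sym (∣p∣≡n⇒p≡⊤ allSettled)) ∈⊤))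
    where
    ∣R∣≤c : ∣ blocked st ∣ ≤ c
    ∣R∣≤c = ≤-trans (bounded st) (∣p∣≤n (settled st))
    allSettled : ∣ settled st ∣ ≡ c
    allSettled = ≤-antisym (∣p∣≤n (settled st))
      (≤-trans c≤1+k (≤-trans (≰⇒> ∣R∣≰k) (bounded st)))

  noCompleteCF : 1 ≤ k → c ≤ suc k → k + c * (k + k) ≤ n → ¬ IsCompleteCFColouring C
  noCompleteCF k≥1 c≤1+k room cf
    with stabilise k≥1 c start (trans (cong (c +_) (∣⊥∣≡0 c)) (+-identityʳ c))
  ... | st , stable =
    large-refutes c≤1+k (≤-trans (+-monoʳ-≤ k c≤c*2k) room) st (small-refutes cf room st stable)
    where
    c≤c*2k : c ≤ c * (k + k)
    c≤c*2k = ≤-trans (≤-reflexive (sym (*-identityʳ c))) (*-monoʳ-≤ c (≤-trans k≥1 (m≤m+n k k)))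

-- k + (k+1)·2k ≤ k(k+1)² + 1 for k ≥ 1; the difference is (k-1)(k²+k-1).
roomBound : ∀ k → 1 ≤ k → k + suc k * (k + k) ≤ k * (suc k * suc k) + 1
roomBound (suc m) _ = ≤-trans (m≤m+n _ (m * (m * m + 3 * m + 1))) (≤-reflexive (identity m))
  where
  identity : ∀ m → suc m + suc (suc m) * (suc m + suc m) + m * (m * m + 3 * m + 1)
                   ≡ suc m * (suc (suc m) * suc (suc m)) + 1
  identity = solve-∀

theorem5 : (n k : ℕ) → 1 ≤ k → k * (suc k * suc k) + 1 ≤ n →
    (C : KVertex n k → Fin (suc k)) → ¬ IsCompleteCFColouring C
theorem5 n k k≥1 big C =
  Colouring.noCompleteCF C k≥1 ≤-refl (≤-trans (roomBound k k≥1) big)
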